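{- In the graceful game, Bob has a winning strategy on every web graph $W(t,n)$ with $t\geq 2$ and $n\geq 3$ (no matter who starts).
   Context: The web graph $W(t,n)$ ($t\geq 2$, $n\geq 3$) has vertices $v_0$ (center), $v_1,\dots,v_n$ (pendent vertices) and $v_{in+1},\dots,v_{(i+1)n}$ for $i=1,\dots,t$, where for each $i\in\{1,\dots,t\}$ the vertices $v_{in+1},\dots,v_{(i+1)n}$ induce an $n$-cycle in this cyclic order (the $t$ concentric cycles); for each $k\in\{1,\dots,n\}$ the vertices $v_k,v_{n+k},v_{2n+k},\dots,v_{tn+k},v_0$ form a path in this order; there are no other edges. Thus $W(t,n)$ has $n(t+1)+1$ vertices and $m=n(2t+1)$ edges. A graceful labeling of a graph $G$ with $m$ edges is an injective map $f\colon V(G)\to\{0,1,\dots,m\}$ such that the induced edge labels $|f(u)-f(v)|$, $uv\in E(G)$, are pairwise distinct. The graceful game on a simple graph $G$ with $m$ edges: two players, Alice and Bob, alternately choose a free (not yet labeled) vertex and assign to it a label from $\{0,1,\dots,m\}$ not yet used. An edge both of whose endpoints are labeled gets label $|f(u)-f(v)|$; a move is legal only if after it all edge labels are pairwise distinct. Alice wins if the whole graph ends up gracefully labeled; Bob wins if he can prevent this. Either player may be the first to move. -}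

module Defs where

open import Data.Nat using (ℕ; zero; suc; _+_; _*_; _≤_; _<_; ∣_-_∣)
open import Data.Nat.Properties using (_≟_)
open import Data.List using (List; []; _∷_; _++_; length; lookup; map; concatMap; upTo)
open import Data.Fin using (Fin)
open import Data.Maybe using (Maybe; just; nothing)
open import Data.Product using (_×_; _,_; ∃)
open import Data.Empty using (⊥)
open import Relation.Nullary using (¬_; yes; no)
open import Relation.Binary.PropositionalEquality using (_≡_; _≢_)

-- A finite graph: vertices 0 … V-1, edges an explicit list of vertex pairs.
record Graph : Set where
  constructor mkGraph
  field
    V : ℕ
    E : List (ℕ × ℕ)

open Graph public

#E : Graph → ℕ
#E G = length (E G)

-- Vertex v_j is the natural number j, 0 ≤ j ≤ n(t+1).
-- Cycle i (1 ≤ i ≤ t) consists of v_{in+1}, …, v_{in+n} in cyclic order;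
-- spokes: v_k — v_{n+k} — v_{2n+k} — … — v_{tn+k} — v_0  for 1 ≤ k ≤ n.
webV : ℕ → ℕ → ℕ
webV t n = suc (n * suc t)

-- position (1-based) following position suc k' on an n-cycle: k'+2, or 1 if k'+1 = n
nextPos : ℕ → ℕ → ℕ
nextPos n k' with suc k' ≟ n
... | yes _ = 1
... | no  _ = suc (suc k')

cycleEdges : ℕ → ℕ → List (ℕ × ℕ)
cycleEdges t n =
  concatMap (λ i' → map (λ k' → (suc i' * n + suc k' , suc i' * n + nextPos n k'))
                        (upTo n))
            (upTo t)

spokeEdges : ℕ → ℕ → List (ℕ × ℕ)
spokeEdges t n =
  concatMap (λ k' → map (λ i → (i * n + suc k' , suc i * n + suc k')) (upTo t)
                    ++ ((t * n + suc k' , 0) ∷ []))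
            (upTo n)

web : ℕ → ℕ → Graph
web t n = mkGraph (webV t n) (cycleEdges t n ++ spokeEdges t n)

-- a partial labeling: nothing = vertex still free
Labeling : Set
Labeling = ℕ → Maybe ℕ

empty : Labeling
empty _ = nothing

assign : Labeling → ℕ → ℕ → Labeling
assign f v l u with u ≟ v
... | yes _ = just l
... | no  _ = f u

edgeLabel : Labeling → ℕ × ℕ → Maybe ℕ
edgeLabel f (u , v) with f u | f v
... | just a | just b = just ∣ a - b ∣
... | _      | _      = nothing

EdgeLabelsDistinct : Graph → Labeling → Set
EdgeLabelsDistinct G f =
  (i j : Fin (length (E G))) → i ≢ j → (a b : ℕ) →
  edgeLabel f (lookup (E G) i) ≡ just a →
  edgeLabel f (lookup (E G) j) ≡ just b → a ≢ b

Complete : Graph → Labeling → Set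
Complete G f = (v : ℕ) → v < V G → ∃ λ a → f v ≡ just a

Legal : Graph → Labeling → ℕ → ℕ → Set
Legal G f v l =
  v < V G × f v ≡ nothing × l ≤ #E G ×
  ((u : ℕ) → u < V G → f u ≢ just l) ×
  EdgeLabelsDistinct G (assign f v l)

data Player : Set where
  alice bob : Player

-- The game ends when all vertices
-- are labeled (Alice wins) or the player to move has no legal move (Bob wins).
data BobWins (G : Graph) : Player → Labeling → Set where
  bob-move  : ∀ f v l → ¬ Complete G f → Legal G f v l →
              BobWins G alice (assign f v l) → BobWins G bob f
  bob-stuck : ∀ f → ¬ Complete G f → (∀ v l → ¬ Legal G f v l) →
              BobWins G bob f
  alice-any : ∀ f → ¬ Complete G f →
              (∀ v l → Legal G f v l → BobWins G bob (assign f v l)) →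
              BobWins G alice f

-- A graph with M edges is gracefully labelled only if every difference
-- 1 … M occurs as an edge label.  The difference M needs the labels 0 and M on
-- adjacent vertices, and M-1 needs 0, M-1 or 1, M.  Bob puts 0 (or M) on a pendent
-- vertex ("leaf"); its only neighbour ("stem") must then get the other extreme.
-- Bob either places that extreme elsewhere first, or, once Alice has put it on the
-- stem, labels a second leaf so that M-1 can no longer occur.  Having three
-- leaves with distinct stems, plus a centre far from them, Bob always finds room.
module Submission where

open import Defs
open import Data.Nat
  using (ℕ; zero; suc; pred; _+_; _*_; _≤_; _<_; _≤?_; _<?_; z≤n; s≤s; z<s; ∣_-_∣; >-nonZero;
         anyUpTo?; allUpTo?)
open import Data.Nat.Properties
open import Data.Fin using (Fin; toℕ; fromℕ<) renaming (zero to fzero; suc to fsuc)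
import Data.Fin.Properties as Fin
open import Data.List using (List; []; _∷_; _++_; length; lookup; map; concatMap; upTo)
open import Data.List.Properties using (length-++; length-++-≤ʳ; length-upTo)
open import Data.List.Relation.Unary.All using (All; []; _∷_)
import Data.List.Relation.Unary.All as All
open import Data.List.Relation.Unary.All.Properties using (++⁺; concat⁺; map⁺; applyUpTo⁺₁)
open import Data.List.Membership.Propositional using (_∈_)
open import Data.List.Membership.Propositional.Properties using (∈-lookup)
open import Data.Maybe using (Maybe; just; nothing)
open import Data.Maybe.Properties using (just-injective)
import Data.Maybe.Properties as Maybe
open import Data.Product using (_×_; _,_; ∃; ∃₂; proj₁; proj₂; uncurry)
open import Data.Sum using (_⊎_; inj₁; inj₂)
import Data.Sum as Sum
open import Data.Empty using (⊥; ⊥-elim)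
open import Relation.Nullary using (¬_; Dec; yes; no; contradiction)
open import Relation.Nullary.Decidable using (_×-dec_; _⊎-dec_; _→-dec_; ¬?; map′)
open import Relation.Binary.PropositionalEquality

nothing≢just : ∀ {c : ℕ} → nothing ≢ just c
nothing≢just ()

assign-same : ∀ f v l → assign f v l v ≡ just l
assign-same f v l with v ≟ v
... | yes _  = refl
... | no v≢v = contradiction refl v≢v

assign-other : ∀ f v l {u} → u ≢ v → assign f v l u ≡ f u
assign-other f v l {u} u≢v with u ≟ v
... | yes u≡v = contradiction u≡v u≢v
... | no _    = refl

assign-inv : ∀ f v l u {c} → assign f v l u ≡ just c → (u ≡ v × c ≡ l) ⊎ f u ≡ just c
assign-inv f v l u e with u ≟ v
... | yes u≡v = inj₁ (u≡v , sym (just-injective e))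
... | no _    = inj₂ e

assign-keeps : ∀ f v l u {c} → f v ≡ nothing → f u ≡ just c → assign f v l u ≡ just c
assign-keeps f v l u fv fu =
  trans (assign-other f v l (λ { refl → nothing≢just (trans (sym fv) fu) })) fu

edgeLabel-just : ∀ f u v {c} → edgeLabel f (u , v) ≡ just c →
                 ∃₂ λ x y → f u ≡ just x × f v ≡ just y × ∣ x - y ∣ ≡ c
edgeLabel-just f u v e with f u | f v
... | just x  | just y  = x , y , refl , refl , just-injective e
... | just _  | nothing = ⊥-elim (nothing≢just e)
... | nothing | _       = ⊥-elim (nothing≢just e)

edgeLabel-of : ∀ f {u v x y} → f u ≡ just x → f v ≡ just y →
               edgeLabel f (u , v) ≡ just ∣ x - y ∣
edgeLabel-of f fu fv rewrite fu | fv = refl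

∣-∣-orient : ∀ x y → y ≡ x + ∣ x - y ∣ ⊎ x ≡ y + ∣ x - y ∣
∣-∣-orient x y with ≤-total x y
... | inj₁ x≤y = inj₁ (trans (sym (m+[n∸m]≡n x≤y)) (cong (x +_) (sym (m≤n⇒∣m-n∣≡n∸m x≤y))))
... | inj₂ y≤x = inj₂ (trans (sym (m+[n∸m]≡n y≤x)) (cong (y +_) (sym (m≤n⇒∣n-m∣≡n∸m y≤x))))

-- Pigeonhole: an injective family of N numbers from {1,…,N} takes every value
-- in {1,…,N}; an omitted value e would extend it to an injection Fin (N+1) → Fin N.
injective-fills : ∀ N (a : Fin N → ℕ) → (∀ i → 1 ≤ a i × a i ≤ N) →
                  (∀ {i j} → a i ≡ a j → i ≡ j) →
                  ∀ {e} → 1 ≤ e → e ≤ N → ¬ (∀ i → a i ≢ e)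
injective-fills N a range a-inj {e} 1≤e e≤N omitted =
  <-irrefl refl (Fin.injective⇒≤ h-inj)
  where
  code : ∀ {c} → 1 ≤ c → c ≤ N → Fin N
  code {suc c} _ c<N = fromℕ< c<N

  code-inj : ∀ {c d} (p : 1 ≤ c) q (p′ : 1 ≤ d) q′ → code p q ≡ code p′ q′ → c ≡ d
  code-inj {suc c} {suc d} _ q _ q′ eq =
    cong suc (trans (sym (Fin.toℕ-fromℕ< q)) (trans (cong toℕ eq) (Fin.toℕ-fromℕ< q′)))

  h : Fin (suc N) → Fin N
  h fzero    = code 1≤e e≤N
  h (fsuc i) = code (proj₁ (range i)) (proj₂ (range i))

  h-inj : ∀ {i j} → h i ≡ h j → i ≡ j
  h-inj {fzero}  {fzero}  _  = refl
  h-inj {fzero}  {fsuc j} eq = ⊥-elim (omitted j (sym (code-inj _ _ _ _ eq)))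
  h-inj {fsuc i} {fzero}  eq = ⊥-elim (omitted i (code-inj _ _ _ _ eq))
  h-inj {fsuc i} {fsuc j} eq = cong fsuc (a-inj (code-inj _ _ _ _ eq))

Adjacent : Graph → ℕ → ℕ → Set
Adjacent G u v = (u , v) ∈ E G ⊎ (v , u) ∈ E G

Proper : Graph → Set
Proper G = ∀ {u v} → (u , v) ∈ E G → u < V G × v < V G × u ≢ v

module Game (G : Graph) where

  M : ℕ
  M = #E G

  -- The invariant maintained by legal play: labels are pairwise distinct, lie in
  -- {0,…,M}, sit on vertices of G only, and induce pairwise distinct edge labels.
  record WellFormed (f : Labeling) : Set where
    field
      injective : ∀ {u v a} → f u ≡ just a → f v ≡ just a → u ≡ v
      bounded   : ∀ {u a} → f u ≡ just a → a ≤ M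
      outside   : ∀ {u} → V G ≤ u → f u ≡ nothing
      distinct  : EdgeLabelsDistinct G f

  open WellFormed public

  wellFormed-empty : WellFormed empty
  wellFormed-empty = record
    { injective = λ ()
    ; bounded   = λ ()
    ; outside   = λ _ → refl
    ; distinct  = λ i _ _ _ _ e → ⊥-elim (unlabelled (lookup (E G) i) e)
    }
    where
    unlabelled : ∀ p {c} → edgeLabel empty p ≢ just c
    unlabelled (u , v) ()

  wellFormed-move : ∀ {f v l} → WellFormed f → Legal G f v l → WellFormed (assign f v l)
  wellFormed-move {f} {v} {l} wf (v<V , _ , l≤M , unused , distinct′) = record
    { injective = λ {u} {w} → injective′ {u} {w}
    ; bounded   = λ {u} → bounded′ {u}
    ; outside   = λ V≤u → trans (assign-other f v l (λ { refl → <⇒≱ v<V V≤u })) (outside wf V≤u)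
    ; distinct  = distinct′
    }
    where
    fresh : ∀ {u} → f u ≢ just l
    fresh {u} fu with u <? V G
    ... | yes u<V = unused u u<V fu
    ... | no u≮V  = nothing≢just (trans (sym (outside wf (≮⇒≥ u≮V))) fu)

    injective′ : ∀ {u w a} → assign f v l u ≡ just a → assign f v l w ≡ just a → u ≡ w
    injective′ {u} {w} eu ew with assign-inv f v l u eu | assign-inv f v l w ew
    ... | inj₁ (u≡v , _)    | inj₁ (w≡v , _)    = trans u≡v (sym w≡v)
    ... | inj₁ (_ , refl)   | inj₂ fw           = ⊥-elim (fresh fw)
    ... | inj₂ fu           | inj₁ (_ , refl)   = ⊥-elim (fresh fu)
    ... | inj₂ fu           | inj₂ fw           = injective wf fu fw

    bounded′ : ∀ {u a} → assign f v l u ≡ just a → a ≤ M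
    bounded′ {u} eu with assign-inv f v l u eu
    ... | inj₁ (_ , refl) = l≤M
    ... | inj₂ fu         = bounded wf fu

  _⊑_ : Labeling → Labeling → Set
  f ⊑ g = ∀ {u a} → f u ≡ just a → g u ≡ just a

  Doomed : Labeling → Set
  Doomed f = ∀ g → f ⊑ g → WellFormed g → Complete G g → ⊥

  doomed-move : ∀ {f v l} → f v ≡ nothing → Doomed f → Doomed (assign f v l)
  doomed-move fv doomed g ext = doomed g (λ {u} fu → ext (assign-keeps _ _ _ u fv fu))

  free⇒incomplete : ∀ {f v} → v < V G → f v ≡ nothing → ¬ Complete G f
  free⇒incomplete v<V fv complete with complete _ v<V
  ... | _ , fv′ = nothing≢just (trans (sym fv) fv′)

  -- Number of free vertices among 0, …, k-1: the measure that makes the game finite.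
  isFree : Maybe ℕ → ℕ
  isFree nothing  = 1
  isFree (just _) = 0

  freeBelow : Labeling → ℕ → ℕ
  freeBelow f zero    = 0
  freeBelow f (suc k) = isFree (f k) + freeBelow f k

  freeBelow-assign-≤ : ∀ f v l k → freeBelow (assign f v l) k ≤ freeBelow f k
  freeBelow-assign-≤ f v l zero = z≤n
  freeBelow-assign-≤ f v l (suc k) = +-mono-≤ (isFree-assign k) (freeBelow-assign-≤ f v l k)
    where
    isFree-assign : ∀ u → isFree (assign f v l u) ≤ isFree (f u)
    isFree-assign u with u ≟ v
    ... | yes _ = z≤n
    ... | no _  = ≤-refl

  freeBelow-assign-< : ∀ f v l {k} → f v ≡ nothing → v < k →
                       freeBelow (assign f v l) k < freeBelow f k
  freeBelow-assign-< f v l {suc k} fv v<1+k with v ≟ k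
  ... | yes refl rewrite assign-same f v l | fv = s≤s (freeBelow-assign-≤ f v l v)
  ... | no v≢k rewrite assign-other f v l {k} (λ k≡v → v≢k (sym k≡v)) =
    +-monoʳ-< (isFree (f k)) (freeBelow-assign-< f v l fv (≤∧≢⇒< (≤-pred v<1+k) v≢k))

  legal? : ∀ f v l → Dec (Legal G f v l)
  legal? f v l =
    v <? V G ×-dec free? (f v) ×-dec l ≤? M ×-dec unused? ×-dec distinct? (assign f v l)
    where
    free? : (m : Maybe ℕ) → Dec (m ≡ nothing)
    free? nothing  = yes refl
    free? (just _) = no λ ()

    unused? : Dec ((u : ℕ) → u < V G → f u ≢ just l)
    unused? = map′ (λ h u u<V → h {u} u<V) (λ h {u} u<V → h u u<V)
                   (allUpTo? (λ u → ¬? (Maybe.≡-dec _≟_ (f u) (just l))) (V G))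

    different? : (x y : Maybe ℕ) → Dec (∀ a b → x ≡ just a → y ≡ just b → a ≢ b)
    different? nothing  _        = yes λ _ _ ()
    different? (just _) nothing  = yes λ _ _ _ ()
    different? (just x) (just y) with x ≟ y
    ... | yes x≡y = no λ h → h x y refl refl x≡y
    ... | no x≢y  = yes λ { _ _ refl refl → x≢y }

    distinct? : ∀ g → Dec (EdgeLabelsDistinct G g)
    distinct? g = Fin.all? λ i → Fin.all? λ j →
      ¬? (i Fin.≟ j) →-dec different? (edgeLabel g (lookup (E G) i)) (edgeLabel g (lookup (E G) j))

  move? : ∀ f → Dec (∃₂ λ v l → Legal G f v l)
  move? f = map′ (λ { (v , _ , l , _ , legal) → v , l , legal })
                 (λ { (v , l , legal) → v , proj₁ legal , l , s≤s (proj₁ (proj₂ (proj₂ legal))) , legal })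
                 (anyUpTo? (λ v → anyUpTo? (legal? f v) (suc M)) (V G))

  -- From a doomed position Bob wins by playing any legal move: each move fills a free
  -- vertex, so the game ends, and it cannot end with the graph completely labelled.
  doomed⇒bobWins : ∀ p f → WellFormed f → Doomed f → BobWins G p f
  doomed⇒bobWins p f = play (freeBelow f (V G)) p f ≤-refl
    where
    incomplete : ∀ {f} → WellFormed f → Doomed f → ¬ Complete G f
    incomplete wf doomed = doomed _ (λ e → e) wf

    play : ∀ k p f → freeBelow f (V G) ≤ k → WellFormed f → Doomed f → BobWins G p f
    next : ∀ k p {f v l} → freeBelow f (V G) ≤ k → Legal G f v l →
           WellFormed f → Doomed f → BobWins G p (assign f v l)

    play k alice f bound wf doomed =
      alice-any f (incomplete wf doomed) λ v l legal → next k bob bound legal wf doomed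
    play k bob f bound wf doomed with move? f
    ... | no stuck = bob-stuck f (incomplete wf doomed) λ v l legal → stuck (v , l , legal)
    ... | yes (v , l , legal) =
      bob-move f v l (incomplete wf doomed) legal (next k alice bound legal wf doomed)

    next zero p bound (v<V , fv , _) _ _ =
      ⊥-elim (<⇒≱ (≤-<-trans z≤n (freeBelow-assign-< _ _ 0 fv v<V)) bound)
    next (suc k) p bound legal@(v<V , fv , _) wf doomed =
      play k p _ (≤-pred (≤-trans (freeBelow-assign-< _ _ _ fv v<V) bound))
           (wellFormed-move wf legal) (doomed-move fv doomed)

  winning-move : ∀ {f v l} → WellFormed f → Legal G f v l → Doomed (assign f v l) → BobWins G bob f
  winning-move wf legal@(v<V , fv , _) doomed =
    bob-move _ _ _ (free⇒incomplete v<V fv) legal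
             (doomed⇒bobWins alice _ (wellFormed-move wf legal) doomed)

  -- A vertex whose neighbours are all free may receive any fresh label in {0,…,M}:
  -- the move labels no edge, so edge labels stay distinct.
  isolated-move : Proper G → ∀ {f v l} → WellFormed f → v < V G → f v ≡ nothing → l ≤ M →
                  (∀ u → f u ≢ just l) → (∀ {u} → Adjacent G v u → f u ≡ nothing) →
                  Legal G f v l
  isolated-move proper {f} {v} {l} wf v<V fv l≤M fresh neighbours-free =
    v<V , fv , l≤M , (λ u _ → fresh u) ,
    λ i j i≢j a b ei ej →
      distinct wf i j i≢j a b (unchanged (∈-lookup i) ei) (unchanged (∈-lookup j) ej)
    where
    unchanged : ∀ {u w c} → (u , w) ∈ E G →
                edgeLabel (assign f v l) (u , w) ≡ just c → edgeLabel f (u , w) ≡ just c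
    unchanged {u} {w} uw e with edgeLabel-just _ u w e
    ... | x , y , gu , gw , refl with assign-inv f v l u gu | assign-inv f v l w gw
    ... | inj₁ (refl , _) | inj₁ (refl , _) = ⊥-elim (proj₂ (proj₂ (proper uw)) refl)
    ... | inj₁ (refl , _) | inj₂ fw = ⊥-elim (nothing≢just (trans (sym (neighbours-free (inj₁ uw))) fw))
    ... | inj₂ fu | inj₁ (refl , _) = ⊥-elim (nothing≢just (trans (sym (neighbours-free (inj₂ uw))) fu))
    ... | inj₂ fu | inj₂ fw = edgeLabel-of f fu fw

  Realises : Labeling → ℕ → ℕ → Set
  Realises g a b = ∃₂ λ u v → Adjacent G u v × g u ≡ just a × g v ≡ just b

  realises-sym : ∀ {g a b} → Realises g a b → Realises g b a
  realises-sym (u , v , uv , gu , gv) = v , u , Sum.swap uv , gv , gu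

  edge-realises : ∀ {g u v e} → (u , v) ∈ E G → edgeLabel g (u , v) ≡ just e →
                  ∃ λ y → Realises g y (y + e)
  edge-realises {g} {u} {v} uv e with edgeLabel-just g u v e
  ... | x , y , gu , gv , refl with ∣-∣-orient x y
  ... | inj₁ y≡ = x , u , v , inj₁ uv , gu , trans gv (cong just y≡)
  ... | inj₂ x≡ = y , v , u , inj₂ uv , gv , trans gu (cong just x≡)

  -- In a complete well-formed labeling of a proper graph every edge has a label in
  -- {1,…,M}: its ends are labelled, by distinct numbers at most M.
  edge-label-range : Proper G → ∀ {g u v} → WellFormed g → Complete G g → (u , v) ∈ E G →
                     ∃ λ c → edgeLabel g (u , v) ≡ just c × 1 ≤ c × c ≤ M
  edge-label-range proper {g} {u} {v} wf complete uv with proper uv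
  ... | u<V , v<V , u≢v with complete u u<V | complete v v<V
  ... | x , gu | y , gv =
    ∣ x - y ∣ , edgeLabel-of g gu gv ,
    n≢0⇒n>0 (λ x≈y → u≢v (injective wf gu (subst (λ s → g v ≡ just s) (sym (∣m-n∣≡0⇒m≡n x≈y)) gv))) ,
    ≤-trans (∣m-n∣≤m⊔n x y) (⊔-lub (bounded wf gu) (bounded wf gv))

  -- A complete well-formed labeling of a proper graph is graceful: its M edge labels
  -- are distinct numbers in {1,…,M}, so by pigeonhole every difference 1 … M occurs.
  every-difference-realised : Proper G → ∀ {g} → WellFormed g → Complete G g →
                              ∀ {e} → 1 ≤ e → e ≤ M → ∃ λ y → Realises g y (y + e)
  every-difference-realised proper {g} wf complete {e} 1≤e e≤M
    with Fin.any? (λ i → Maybe.≡-dec _≟_ (edgeLabel g (lookup (E G) i)) (just e))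
  ... | yes (i , ei) = edge-realises (∈-lookup i) ei
  ... | no none = ⊥-elim (injective-fills M label label-range label-injective 1≤e e≤M
                    λ i label≡e → none (i , trans (label-spec i) (cong just label≡e)))
    where
    label : Fin M → ℕ
    label i = proj₁ (edge-label-range proper wf complete (∈-lookup i))

    label-spec : ∀ i → edgeLabel g (lookup (E G) i) ≡ just (label i)
    label-spec i = proj₁ (proj₂ (edge-label-range proper wf complete (∈-lookup i)))

    label-range : ∀ i → 1 ≤ label i × label i ≤ M
    label-range i = proj₂ (proj₂ (edge-label-range proper wf complete (∈-lookup i)))

    label-injective : ∀ {i j} → label i ≡ label j → i ≡ j
    label-injective {i} {j} eq with i Fin.≟ j
    ... | yes i≡j = i≡j
    ... | no i≢j  = ⊥-elim (distinct wf i j i≢j _ _ (label-spec i) (label-spec j) eq)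

record Pendants (G : Graph) : Set where
  field
    leaf stem      : Fin 3 → ℕ
    hub            : ℕ
    leaf-injective : ∀ {j k} → leaf j ≡ leaf k → j ≡ k
    stem-injective : ∀ {j k} → stem j ≡ stem k → j ≡ k
    leaf≢stem      : ∀ j k → leaf j ≢ stem k
    hub≢leaf       : ∀ k → hub ≢ leaf k
    hub≢stem       : ∀ k → hub ≢ stem k
    leaf<V         : ∀ k → leaf k < V G
    stem<V         : ∀ k → stem k < V G
    hub<V          : hub < V G
    leaf-pendant   : ∀ k {u} → Adjacent G (leaf k) u → u ≡ stem k
    hub-far        : ∀ k {u} → Adjacent G hub u → u ≢ leaf k × u ≢ stem k

module Strategy (G : Graph) (proper : Proper G) (P : Pendants G) (3≤M : 3 ≤ #E G) where
  open Game G
  open Pendants P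

  M′ : ℕ
  M′ = pred M

  suc-M′ : suc M′ ≡ M
  suc-M′ = suc-pred M {{>-nonZero (≤-trans (s≤s z≤n) 3≤M)}}

  2≤M′ : 2 ≤ M′
  2≤M′ = ≤-pred (subst (3 ≤_) (sym suc-M′) 3≤M)

  realises-0-M : ∀ {g} → WellFormed g → Complete G g → Realises g 0 M
  realises-0-M wf complete
    with every-difference-realised proper wf complete (≤-trans (s≤s z≤n) 3≤M) ≤-refl
  ... | y , r@(_ , _ , _ , _ , gv)
    with n≤0⇒n≡0 (+-cancelʳ-≤ M y 0 (bounded wf gv))
  ... | refl = r

  realises-M′ : ∀ {g} → WellFormed g → Complete G g → Realises g 0 M′ ⊎ Realises g 1 M
  realises-M′ wf complete
    with every-difference-realised proper wf complete (≤-trans (s≤s z≤n) 2≤M′) pred[n]≤n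
  ... | y , r@(u , v , uv , gu , gv)
    with n≤1⇒n≡0∨n≡1 (+-cancelʳ-≤ M′ y 1 (subst (y + M′ ≤_) (sym suc-M′) (bounded wf gv)))
  ... | inj₁ refl = inj₁ r
  ... | inj₂ refl = inj₂ (u , v , uv , gu , trans gv (cong just suc-M′))

  -- Bob's two plans, exchanged by the symmetry l ↦ M - l.  In Config z z′ w ŵ Bob
  -- labels a leaf with z; the difference M forces its stem to get z′, and the
  -- difference M-1 needs one of the pairs (z , ŵ) and (w , z′).
  data Config : ℕ → ℕ → ℕ → ℕ → Set where
    low  : Config 0 M 1 M′
    high : Config M 0 M′ 1

  config-M : ∀ {z z′ w ŵ g} → Config z z′ w ŵ → WellFormed g → Complete G g → Realises g z z′
  config-M low  wf complete = realises-0-M wf complete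
  config-M high wf complete = realises-sym (realises-0-M wf complete)

  config-M′ : ∀ {z z′ w ŵ g} → Config z z′ w ŵ → WellFormed g → Complete G g →
              Realises g z ŵ ⊎ Realises g w z′
  config-M′ low  wf complete = realises-M′ wf complete
  config-M′ high wf complete = Sum.map realises-sym realises-sym (Sum.swap (realises-M′ wf complete))

  M≢0 : M ≢ 0
  M≢0 M≡0 = <⇒≢ (≤-trans (s≤s z≤n) 3≤M) (sym M≡0)

  z≢z′ : ∀ {z z′ w ŵ} → Config z z′ w ŵ → z ≢ z′
  z≢z′ low  = λ 0≡M → M≢0 (sym 0≡M)
  z≢z′ high = M≢0

  z≢w : ∀ {z z′ w ŵ} → Config z z′ w ŵ → z ≢ w
  z≢w low  = λ ()
  z≢w high = λ M≡M′ → 1+n≢n (trans suc-M′ M≡M′)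

  ŵ≢z′ : ∀ {z z′ w ŵ} → Config z z′ w ŵ → ŵ ≢ z′
  ŵ≢z′ low  = λ M′≡M → 1+n≢n (trans suc-M′ (sym M′≡M))
  ŵ≢z′ high = λ ()

  z′≢w : ∀ {z z′ w ŵ} → Config z z′ w ŵ → z′ ≢ w
  z′≢w low  = λ M≡1 → <⇒≢ (≤-trans (s≤s (s≤s z≤n)) 3≤M) (sym M≡1)
  z′≢w high = λ 0≡M′ → <⇒≢ (≤-trans (s≤s z≤n) 2≤M′) 0≡M′

  z≤M : ∀ {z z′ w ŵ} → Config z z′ w ŵ → z ≤ M
  z≤M low  = z≤n
  z≤M high = ≤-refl

  z′≤M : ∀ {z z′ w ŵ} → Config z z′ w ŵ → z′ ≤ M
  z′≤M low  = ≤-refl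
  z′≤M high = z≤n

  w≤M : ∀ {z z′ w ŵ} → Config z z′ w ŵ → w ≤ M
  w≤M low  = ≤-trans (s≤s z≤n) 3≤M
  w≤M high = pred[n]≤n

  -- A leaf's only neighbour is its stem, so a pair realised with the label of a
  -- leaf is realised on that leaf and its stem.
  leaf-partner : ∀ {g k a b} → WellFormed g → g (leaf k) ≡ just a → Realises g a b →
                 g (stem k) ≡ just b
  leaf-partner {g} {k} {b = b} wf gk (u , v , uv , gu , gv) with injective wf gu gk
  ... | refl = subst (λ s → g s ≡ just b) (leaf-pendant k uv) gv

  stem-forced : ∀ {z z′ w ŵ g k} → Config z z′ w ŵ → WellFormed g → Complete G g →
                g (leaf k) ≡ just z → g (stem k) ≡ just z′
  stem-forced cf wf complete gk = leaf-partner wf gk (config-M cf wf complete)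

  doomed-by-stem : ∀ {z z′ w ŵ f k b} → Config z z′ w ŵ → f (leaf k) ≡ just z →
                   f (stem k) ≡ just b → b ≢ z′ → Doomed f
  doomed-by-stem cf fk fs b≢z′ g ext wf complete =
    b≢z′ (just-injective (trans (sym (ext fs)) (stem-forced cf wf complete (ext fk))))

  doomed-by-partner : ∀ {z z′ w ŵ f k u} → Config z z′ w ŵ → f (leaf k) ≡ just z →
                      f u ≡ just z′ → u ≢ stem k → Doomed f
  doomed-by-partner cf fk fu u≢stem g ext wf complete =
    u≢stem (injective wf (ext fu) (stem-forced cf wf complete (ext fk)))

  doomed-by-triple : ∀ {z z′ w ŵ f k r} → Config z z′ w ŵ → r ≢ k → f (leaf k) ≡ just z →
                     f (stem k) ≡ just z′ → f (leaf r) ≡ just w → Doomed f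
  doomed-by-triple cf r≢k fk fs fr g ext wf complete with config-M′ cf wf complete
  ... | inj₁ zŵ = ŵ≢z′ cf (just-injective (trans (sym (leaf-partner wf (ext fk) zŵ)) (ext fs)))
  ... | inj₂ wz′ = r≢k (stem-injective (injective wf (leaf-partner wf (ext fr) wz′) (ext fs)))

  Touches : ℕ → Fin 3 → Set
  Touches v k = v ≡ leaf k ⊎ v ≡ stem k

  touches? : ∀ v k → Dec (Touches v k)
  touches? v k = (v ≟ leaf k) ⊎-dec (v ≟ stem k)

  touches-unique : ∀ {v j k} → Touches v j → Touches v k → j ≡ k
  touches-unique (inj₁ refl) (inj₁ e) = leaf-injective e
  touches-unique (inj₁ refl) (inj₂ e) = ⊥-elim (leaf≢stem _ _ e)
  touches-unique (inj₂ refl) (inj₁ e) = ⊥-elim (leaf≢stem _ _ (sym e))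
  touches-unique (inj₂ refl) (inj₂ e) = stem-injective e

  others : ∀ (i : Fin 3) → ∃₂ λ j k → j ≢ i × k ≢ i × j ≢ k
  others fzero               = fsuc fzero , fsuc (fsuc fzero) , (λ ()) , (λ ()) , (λ ())
  others (fsuc fzero)        = fzero , fsuc (fsuc fzero) , (λ ()) , (λ ()) , (λ ())
  others (fsuc (fsuc fzero)) = fzero , fsuc fzero , (λ ()) , (λ ()) , (λ ())

  untouched-spoke : ∀ x i → ∃ λ j → j ≢ i × ¬ Touches x j
  untouched-spoke x i with others i
  ... | j , k , j≢i , k≢i , j≢k with touches? x j
  ... | no ¬xj = j , j≢i , ¬xj
  ... | yes xj = k , k≢i , λ xk → j≢k (touches-unique xj xk)

  untouched-spoke₂ : ∀ x y i → (∃ λ j → j ≢ i × ¬ Touches x j × ¬ Touches y j) ⊎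
                               (∃ (Touches x) × ∃ (Touches y))
  untouched-spoke₂ x y i with others i
  ... | j , k , j≢i , k≢i , j≢k with touches? x j | touches? y j | touches? x k | touches? y k
  ... | no ¬xj | no ¬yj | _      | _      = inj₁ (j , j≢i , ¬xj , ¬yj)
  ... | _      | _      | no ¬xk | no ¬yk = inj₁ (k , k≢i , ¬xk , ¬yk)
  ... | yes xj | _      | yes xk | _      = ⊥-elim (j≢k (touches-unique xj xk))
  ... | _      | yes yj | _      | yes yk = ⊥-elim (j≢k (touches-unique yj yk))
  ... | yes xj | no _   | no _   | yes yk = inj₂ ((j , xj) , (k , yk))
  ... | no _   | yes yj | yes xk | no _   = inj₂ ((k , xk) , (j , yj))

  record LabelsOnly (f : Labeling) (S : ℕ → Set) : Set where
    constructor labelsOnly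
    field labelled⇒S : ∀ {u c} → f u ≡ just c → S u

  unlabelled : ∀ {f S} u → LabelsOnly f S → ¬ S u → f u ≡ nothing
  unlabelled {f} u (labelsOnly only) ¬Su with f u in fu
  ... | nothing = refl
  ... | just _  = ⊥-elim (¬Su (only fu))

  labels-only-first : ∀ {x a} → LabelsOnly (assign empty x a) (_≡ x)
  labels-only-first {x} {a} = labelsOnly λ {u} e → only-x (assign-inv empty x a u e)
    where
    only-x : ∀ {u c} → (u ≡ x × c ≡ a) ⊎ empty u ≡ just c → u ≡ x
    only-x (inj₁ (u≡x , _)) = u≡x

  labels-only-move : ∀ {f S v l} → LabelsOnly f S → LabelsOnly (assign f v l) (λ u → u ≡ v ⊎ S u)
  labels-only-move {f} {v = v} {l} (labelsOnly only) =
    labelsOnly λ {u} e → Sum.map proj₁ only (assign-inv f v l u e)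

  spoke-free : ∀ {f S j} → LabelsOnly f S → (∀ {u} → Touches u j → ¬ S u) →
               f (leaf j) ≡ nothing × f (stem j) ≡ nothing
  spoke-free {j = j} only untouched =
    unlabelled (leaf j) only (untouched (inj₁ refl)) , unlabelled (stem j) only (untouched (inj₂ refl))

  Unused : Labeling → ℕ → Set
  Unused f l = ∀ u → f u ≢ just l

  unused-move : ∀ {f v b l} → Unused f l → b ≢ l → Unused (assign f v b) l
  unused-move {f} {v} {b} fresh b≢l u e with assign-inv f v b u e
  ... | inj₁ (_ , l≡b) = b≢l (sym l≡b)
  ... | inj₂ fu        = fresh u fu

  leaf-move : ∀ {f j l} → WellFormed f → f (leaf j) ≡ nothing → f (stem j) ≡ nothing →
              l ≤ M → Unused f l → Legal G f (leaf j) l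
  leaf-move {f} {j} wf fl fs l≤M fresh = isolated-move proper wf (leaf<V j) fl l≤M fresh
    λ adj → subst (λ s → f s ≡ nothing) (sym (leaf-pendant j adj)) fs

  hub-move : ∀ {f l} → WellFormed f → LabelsOnly f (λ u → ∃ (Touches u)) →
             l ≤ M → Unused f l → Legal G f hub l
  hub-move wf only l≤M fresh =
    isolated-move proper wf hub<V
      (unlabelled hub only λ { (k , inj₁ e) → hub≢leaf k e ; (k , inj₂ e) → hub≢stem k e })
      l≤M fresh
      λ {u} adj → unlabelled u only λ { (k , inj₁ e) → proj₁ (hub-far k adj) e
                                      ; (k , inj₂ e) → proj₂ (hub-far k adj) e }

  place-partner : ∀ {z z′ w ŵ f i v} → Config z z′ w ŵ → WellFormed f → f (leaf i) ≡ just z →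
                  Legal G f v z′ → v ≢ stem i → BobWins G bob f
  place-partner {z′ = z′} {f = f} {i} {v} cf wf fi legal@(_ , fv , _) v≢stem =
    winning-move wf legal
      (doomed-by-partner cf (assign-keeps f v z′ (leaf i) fv fi) (assign-same f v z′) v≢stem)

  -- Bob puts z′ on the leaf of a spoke other than i
  -- touched by neither x nor y, or on the hub if x and y both lie on spokes.
  misplace-partner : ∀ {z z′ w ŵ f i x y} → Config z z′ w ŵ → WellFormed f → f (leaf i) ≡ just z →
                     LabelsOnly f (λ u → u ≡ y ⊎ u ≡ leaf i ⊎ u ≡ x) → Unused f z′ → BobWins G bob f
  misplace-partner {f = f} {i} {x} {y} cf wf fi only fresh with untouched-spoke₂ x y i
  ... | inj₁ (j , j≢i , ¬xj , ¬yj) =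
    place-partner cf wf fi (leaf-move wf (proj₁ spoke-j) (proj₂ spoke-j) (z′≤M cf) fresh) (leaf≢stem j i)
    where
    spoke-j : f (leaf j) ≡ nothing × f (stem j) ≡ nothing
    spoke-j = spoke-free only λ uj → λ
      { (inj₁ u≡y)        → ¬yj (subst (λ s → Touches s j) u≡y uj)
      ; (inj₂ (inj₁ u≡i)) → j≢i (touches-unique uj (inj₁ u≡i))
      ; (inj₂ (inj₂ u≡x)) → ¬xj (subst (λ s → Touches s j) u≡x uj) }
  ... | inj₂ ((_ , xk) , (_ , yk)) =
    place-partner cf wf fi (hub-move wf on-spokes (z′≤M cf) fresh) (hub≢stem i)
    where
    on-spoke : ∀ {u} → u ≡ y ⊎ u ≡ leaf i ⊎ u ≡ x → ∃ (Touches u)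
    on-spoke (inj₁ refl)        = _ , yk
    on-spoke (inj₂ (inj₁ refl)) = i , inj₁ refl
    on-spoke (inj₂ (inj₂ refl)) = _ , xk

    on-spokes : LabelsOnly f (λ u → ∃ (Touches u))
    on-spokes = labelsOnly λ fu → on-spoke (LabelsOnly.labelled⇒S only fu)

  -- Bob puts w on the leaf of a spoke other than i untouched
  -- by x; now the difference M-1 can no longer be realised.
  complete-triple : ∀ {z z′ w ŵ f i x} → Config z z′ w ŵ → WellFormed f →
                    f (leaf i) ≡ just z → f (stem i) ≡ just z′ →
                    LabelsOnly f (λ u → u ≡ stem i ⊎ u ≡ leaf i ⊎ u ≡ x) → Unused f w →
                    BobWins G bob f
  complete-triple {w = w} {f = f} {i} {x} cf wf fi fs only fresh with untouched-spoke x i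
  ... | j , j≢i , ¬xj =
    winning-move wf legal
      (doomed-by-triple cf j≢i (keep fi) (keep fs) (assign-same f (leaf j) w))
    where
    spoke-j : f (leaf j) ≡ nothing × f (stem j) ≡ nothing
    spoke-j = spoke-free only λ uj → λ
      { (inj₁ u≡s)        → j≢i (touches-unique uj (inj₂ u≡s))
      ; (inj₂ (inj₁ u≡l)) → j≢i (touches-unique uj (inj₁ u≡l))
      ; (inj₂ (inj₂ u≡x)) → ¬xj (subst (λ s → Touches s j) u≡x uj) }

    legal : Legal G f (leaf j) w
    legal = leaf-move wf (proj₁ spoke-j) (proj₂ spoke-j) (w≤M cf) fresh

    keep : ∀ {u c} → f u ≡ just c → assign f (leaf j) w u ≡ just c
    keep {u} = assign-keeps f (leaf j) w u (proj₁ spoke-j)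

  -- Whatever Alice does, Bob wins:
  --   * she labels the stem with b ≠ z′, or puts z′ elsewhere: the position is doomed;
  --   * she labels the stem with z′: Bob completes the triple (complete-triple);
  --   * otherwise: Bob puts z′ away from the stem (misplace-partner).
  alice-to-move : ∀ {z z′ w ŵ f i x} → Config z z′ w ŵ → WellFormed f → f (leaf i) ≡ just z →
                  LabelsOnly f (λ u → u ≡ leaf i ⊎ u ≡ x) → x ≢ stem i →
                  Unused f z′ → Unused f w → BobWins G alice f
  alice-to-move {z} {z′} {f = f} {i} {x} cf wf fi only x≢stem z′-unused w-unused =
    alice-any f (free⇒incomplete (stem<V i) stem-free) reply
    where
    stem-free : f (stem i) ≡ nothing
    stem-free = unlabelled (stem i) only λ
      { (inj₁ s≡l) → leaf≢stem i i (sym s≡l)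
      ; (inj₂ s≡x) → x≢stem (sym s≡x) }

    keep : ∀ {y b} → Legal G f y b → assign f y b (leaf i) ≡ just z
    keep {y} {b} (_ , fy , _) = assign-keeps f y b (leaf i) fy fi

    reply : ∀ y b → Legal G f y b → BobWins G bob (assign f y b)
    reply y b legal with y ≟ stem i | b ≟ z′
    ... | yes refl | no b≢z′ =
      doomed⇒bobWins bob _ (wellFormed-move wf legal) (doomed-by-stem cf (keep legal) (assign-same f y b) b≢z′)
    ... | yes refl | yes refl =
      complete-triple cf (wellFormed-move wf legal) (keep legal) (assign-same f y b)
                      (labels-only-move only) (unused-move w-unused (z′≢w cf))
    ... | no y≢stem | yes refl =
      doomed⇒bobWins bob _ (wellFormed-move wf legal) (doomed-by-partner cf (keep legal) (assign-same f y b) y≢stem)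
    ... | no _ | no b≢z′ =
      misplace-partner cf (wellFormed-move wf legal) (keep legal)
                       (labels-only-move only) (unused-move z′-unused b≢z′)

  -- Bob's choice of plan against Alice's opening label a: a is never the label z
  -- Bob wants for his leaf, and either a is already the partner z′ (which then sits
  -- away from Bob's leaf) or a avoids both z′ and w.
  Opening : ℕ → Set
  Opening a = ∃ λ z → ∃ λ z′ → ∃ λ w → ∃ λ ŵ →
              Config z z′ w ŵ × a ≢ z × (a ≡ z′ ⊎ (a ≢ z′ × a ≢ w))

  opening : ∀ a → Opening a
  opening a with a ≟ 0 | a ≟ M | a ≟ 1
  ... | yes a≡0 | _       | _       = _ , _ , _ , _ , high , (λ a≡M → M≢0 (trans (sym a≡M) a≡0)) , inj₁ a≡0
  ... | no a≢0  | yes a≡M | _       = _ , _ , _ , _ , low , a≢0 , inj₁ a≡M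
  ... | no a≢0  | no a≢M  | yes a≡1 =
    _ , _ , _ , _ , high , a≢M , inj₂ (a≢0 , λ a≡M′ → <⇒≢ 2≤M′ (trans (sym a≡1) a≡M′))
  ... | no a≢0  | no a≢M  | no a≢1  = _ , _ , _ , _ , low , a≢0 , inj₂ (a≢M , a≢1)

  -- Alice opens with label a on x.  Bob labels the leaf of a spoke untouched by x
  -- with z; then either the position is already doomed or Alice is to move in the
  -- situation of alice-to-move.
  alice-starts : BobWins G alice empty
  alice-starts = alice-any empty (free⇒incomplete hub<V refl) reply
    where
    reply : ∀ x a → Legal G empty x a → BobWins G bob (assign empty x a)
    reply x a legal with untouched-spoke x fzero | opening a
    ... | i , _ , ¬xi | z , z′ , w , ŵ , cf , a≢z , placement = answer placement
      where
      f : Labeling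
      f = assign empty x a

      wf : WellFormed f
      wf = wellFormed-move wellFormed-empty legal

      spoke-i : f (leaf i) ≡ nothing × f (stem i) ≡ nothing
      spoke-i = spoke-free labels-only-first λ ui u≡x → ¬xi (subst (λ s → Touches s i) u≡x ui)

      x≢stem : x ≢ stem i
      x≢stem x≡s = ¬xi (inj₂ x≡s)

      leaf-legal : Legal G f (leaf i) z
      leaf-legal = leaf-move wf (proj₁ spoke-i) (proj₂ spoke-i) (z≤M cf) (unused-move (λ _ ()) a≢z)

      answer : a ≡ z′ ⊎ (a ≢ z′ × a ≢ w) → BobWins G bob f
      answer (inj₁ a≡z′) =
        winning-move wf leaf-legal
          (doomed-by-partner cf (assign-same f (leaf i) z)
             (assign-keeps f (leaf i) z x (proj₁ spoke-i) (trans (assign-same empty x a) (cong just a≡z′)))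
             x≢stem)
      answer (inj₂ (a≢z′ , a≢w)) =
        bob-move f (leaf i) z (free⇒incomplete (leaf<V i) (proj₁ spoke-i)) leaf-legal
          (alice-to-move cf (wellFormed-move wf leaf-legal) (assign-same f (leaf i) z)
             (labels-only-move labels-only-first) x≢stem
             (unused-move (unused-move (λ _ ()) a≢z′) (z≢z′ cf))
             (unused-move (unused-move (λ _ ()) a≢w) (z≢w cf)))

  bob-starts : BobWins G bob empty
  bob-starts =
    bob-move empty (leaf fzero) 0 (free⇒incomplete hub<V refl) legal
      (alice-to-move low (wellFormed-move wellFormed-empty legal) (assign-same empty (leaf fzero) 0)
         (labelsOnly λ e → inj₁ (LabelsOnly.labelled⇒S labels-only-first e)) (leaf≢stem fzero fzero)
         (unused-move (λ _ ()) (z≢z′ low)) (unused-move (λ _ ()) (z≢w low)))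
    where
    legal : Legal G empty (leaf fzero) 0
    legal = leaf-move wellFormed-empty refl refl z≤n (λ _ ())

length-concatMap-≥ : ∀ {A B : Set} (f : A → List B) → (∀ x → 1 ≤ length (f x)) →
                     ∀ xs → length xs ≤ length (concatMap f xs)
length-concatMap-≥ f nonempty []       = z≤n
length-concatMap-≥ f nonempty (x ∷ xs) =
  ≤-trans (+-mono-≤ (nonempty x) (length-concatMap-≥ f nonempty xs)) (≤-reflexive (sym (length-++ (f x))))

-- The web graph W(t,n) is proper, has at least three edges, and carries the
-- pendant configuration leaf k = v_{k+1}, stem k = v_{n+k+1}, hub = v_0.
module Web (t n : ℕ) (2≤t : 2 ≤ t) (3≤n : 3 ≤ n) where

  W : Graph
  W = web t n

  row<V : ∀ {j c} → j ≤ t → c ≤ n → j * n + c < webV t n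
  row<V {j} {c} j≤t c≤n = s≤s (begin
    j * n + c     ≤⟨ +-mono-≤ (*-monoˡ-≤ n j≤t) c≤n ⟩
    t * n + n     ≡⟨ +-comm (t * n) n ⟩
    n + t * n     ≡⟨ cong (n +_) (*-comm t n) ⟩
    n + n * t     ≡⟨ sym (*-suc n t) ⟩
    n * suc t     ∎)
    where open ≤-Reasoning

  cycle-beyond : ∀ i {c} → 1 ≤ c → n < suc i * n + c
  cycle-beyond i {c} 1≤c = begin-strict
    n                ≡⟨ sym (+-identityʳ n) ⟩
    n + 0            <⟨ +-monoʳ-< n 1≤c ⟩
    n + c            ≤⟨ +-monoˡ-≤ c (m≤m+n n (i * n)) ⟩
    suc i * n + c    ∎
    where open ≤-Reasoning

  outer-beyond : ∀ {c} → 1 ≤ c → n + n < t * n + c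
  outer-beyond {c} 1≤c = begin-strict
    n + n            ≡⟨ cong (n +_) (sym (+-identityʳ n)) ⟩
    2 * n            ≡⟨ sym (+-identityʳ (2 * n)) ⟩
    2 * n + 0        <⟨ +-monoʳ-< (2 * n) 1≤c ⟩
    2 * n + c        ≤⟨ +-monoˡ-≤ c (*-monoˡ-≤ n 2≤t) ⟩
    t * n + c        ∎
    where open ≤-Reasoning

  nextPos-range : ∀ {k} → k < n → 1 ≤ nextPos n k × nextPos n k ≤ n × nextPos n k ≢ suc k
  nextPos-range {k} k<n with suc k ≟ n
  ... | yes 1+k≡n = s≤s z≤n , ≤-trans (s≤s z≤n) 3≤n ,
                    λ 1≡1+k → <⇒≢ (≤-trans (s≤s (s≤s z≤n)) 3≤n) (trans 1≡1+k 1+k≡n)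
  ... | no 1+k≢n  = s≤s z≤n , ≤∧≢⇒< k<n 1+k≢n , 1+n≢n

  record WebEdge (a b : ℕ) : Set where
    field
      fst<V        : a < webV t n
      snd<V        : b < webV t n
      ends-differ  : a ≢ b
      pendent-fst  : 1 ≤ a → a ≤ n → b ≡ n + a
      pendent-snd  : 1 ≤ b → b ≤ n → ⊥
      centre-not-fst : a ≢ 0
      centre-snd   : b ≡ 0 → n + n < a

  cycle-edge : ∀ {i k} → i < t → k < n → WebEdge (suc i * n + suc k) (suc i * n + nextPos n k)
  cycle-edge {i} {k} i<t k<n with nextPos-range k<n
  ... | 1≤next , next≤n , next≢ = record
    { fst<V          = row<V i<t k<n
    ; snd<V          = row<V i<t next≤n
    ; ends-differ    = λ e → next≢ (sym (+-cancelˡ-≡ (suc i * n) _ _ e))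
    ; pendent-fst    = λ _ a≤n → ⊥-elim (<⇒≱ (cycle-beyond i (s≤s z≤n)) a≤n)
    ; pendent-snd    = λ _ b≤n → <⇒≱ (cycle-beyond i 1≤next) b≤n
    ; centre-not-fst = m+1+n≢0 (suc i * n)
    ; centre-snd     = λ b≡0 → ⊥-elim (<⇒≢ (≤-trans z<s (cycle-beyond i 1≤next)) (sym b≡0))
    }

  spoke-edge : ∀ {i k} → i < t → k < n → WebEdge (i * n + suc k) (suc i * n + suc k)
  spoke-edge {i} {k} i<t k<n = record
    { fst<V          = row<V (<⇒≤ i<t) k<n
    ; snd<V          = row<V i<t k<n
    ; ends-differ    = λ e → <⇒≢ (+-monoˡ-< (i * n + suc k) (≤-trans (s≤s z≤n) 3≤n))
                                  (trans e (+-assoc n (i * n) (suc k)))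
    ; pendent-fst    = λ _ _ → +-assoc n (i * n) (suc k)
    ; pendent-snd    = λ _ b≤n → <⇒≱ (cycle-beyond i (s≤s z≤n)) b≤n
    ; centre-not-fst = m+1+n≢0 (i * n)
    ; centre-snd     = λ b≡0 → ⊥-elim (m+1+n≢0 (suc i * n) b≡0)
    }

  centre-edge : ∀ {k} → k < n → WebEdge (t * n + suc k) 0
  centre-edge {k} k<n = record
    { fst<V          = row<V ≤-refl k<n
    ; snd<V          = s≤s z≤n
    ; ends-differ    = m+1+n≢0 (t * n)
    ; pendent-fst    = λ _ a≤n → ⊥-elim (<⇒≱ (≤-<-trans (m≤m+n n n) (outer-beyond (s≤s z≤n))) a≤n)
    ; pendent-snd    = λ ()
    ; centre-not-fst = m+1+n≢0 (t * n)
    ; centre-snd     = λ _ → outer-beyond (s≤s z≤n)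
    }

  web-edges : All (uncurry WebEdge) (E W)
  web-edges =
    ++⁺ (concat⁺ (map⁺ (applyUpTo⁺₁ _ t λ i<t → map⁺ (applyUpTo⁺₁ _ n λ k<n → cycle-edge i<t k<n))))
        (concat⁺ (map⁺ (applyUpTo⁺₁ _ n λ k<n →
           ++⁺ (map⁺ (applyUpTo⁺₁ _ t λ i<t → spoke-edge i<t k<n)) (centre-edge k<n ∷ []))))

  web-edge : ∀ {a b} → (a , b) ∈ E W → WebEdge a b
  web-edge = All.lookup web-edges

  web-proper : Proper W
  web-proper ab = fst<V , snd<V , ends-differ
    where open WebEdge (web-edge ab)

  path spoke : ℕ → List (ℕ × ℕ)
  path k  = map (λ i → (i * n + suc k , suc i * n + suc k)) (upTo t)
  spoke k = path k ++ (t * n + suc k , 0) ∷ []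

  web-size : 3 ≤ #E W
  web-size = begin
    3                           ≤⟨ 3≤n ⟩
    n                           ≡⟨ sym (length-upTo n) ⟩
    length (upTo n)             ≤⟨ length-concatMap-≥ spoke (λ k → length-++-≤ʳ (_ ∷ []) {path k}) (upTo n) ⟩
    length (concatMap spoke (upTo n)) ≤⟨ length-++-≤ʳ (spokeEdges t n) {cycleEdges t n} ⟩
    #E W                        ∎
    where open ≤-Reasoning

  leaf : Fin 3 → ℕ
  leaf k = suc (toℕ k)

  leaf≤n : ∀ k → leaf k ≤ n
  leaf≤n k = ≤-trans (Fin.toℕ<n k) 3≤n

  leaf-pendant : ∀ k {u} → Adjacent W (leaf k) u → u ≡ n + leaf k
  leaf-pendant k (inj₁ e) = WebEdge.pendent-fst (web-edge e) (s≤s z≤n) (leaf≤n k)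
  leaf-pendant k (inj₂ e) = ⊥-elim (WebEdge.pendent-snd (web-edge e) (s≤s z≤n) (leaf≤n k))

  centre-far : ∀ k {u} → Adjacent W 0 u → u ≢ leaf k × u ≢ n + leaf k
  centre-far k (inj₁ e) = ⊥-elim (WebEdge.centre-not-fst (web-edge e) refl)
  centre-far k {u} (inj₂ e) =
    (λ u≡leaf → <⇒≱ beyond (subst (_≤ n + n) (sym u≡leaf) (≤-trans (leaf≤n k) (m≤m+n n n)))) ,
    (λ u≡stem → <⇒≱ beyond (subst (_≤ n + n) (sym u≡stem) (+-monoʳ-≤ n (leaf≤n k))))
    where
    beyond : n + n < u
    beyond = WebEdge.centre-snd (web-edge e) refl

  web-pendants : Pendants W
  web-pendants = record
    { leaf           = leaf
    ; stem           = λ k → n + leaf k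
    ; hub            = 0
    ; leaf-injective = λ e → Fin.toℕ-injective (suc-injective e)
    ; stem-injective = λ e → Fin.toℕ-injective (suc-injective (+-cancelˡ-≡ n _ _ e))
    ; leaf≢stem      = λ j k → <⇒≢ (≤-<-trans (leaf≤n j) (m<m+n n z<s))
    ; hub≢leaf       = λ k ()
    ; hub≢stem       = λ k 0≡stem → m+1+n≢0 n (sym 0≡stem)
    ; leaf<V         = λ k → row<V z≤n (leaf≤n k)
    ; stem<V         = λ k → subst (_< webV t n) (cong (_+ leaf k) (+-identityʳ n))
                                   (row<V (≤-trans (s≤s z≤n) 2≤t) (leaf≤n k))
    ; hub<V          = z<s
    ; leaf-pendant   = leaf-pendant
    ; hub-far        = centre-far
    }

theorem10 : (t n : ℕ) → 2 ≤ t → 3 ≤ n →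
    BobWins (web t n) alice empty × BobWins (web t n) bob empty
theorem10 t n 2≤t 3≤n = alice-starts , bob-starts
  where
  open Web t n 2≤t 3≤n using (web-proper; web-pendants; web-size)
  open Strategy (web t n) web-proper web-pendants web-size using (alice-starts; bob-starts)
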